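{- Let $\mathbf u$ and $\mathbf u'$ be Sturmian words over $\{0,1\}$ such that $\mathbf u=\varphi_b(\mathbf u')$, where $\varphi_b: 0\mapsto 0,\ 1\mapsto 01$, and let $w'$ be a nonempty right special prefix of $\mathbf u'$. Then $d_{\mathbf u'}(w')=d_{\mathbf u}(w)$, where $w=\varphi_b(w')0$.
   Context: A Sturmian word is an infinite word with exactly $n+1$ factors of length $n$ for all $n$; such words are binary and uniformly recurrent. For a prefix $w$ of a uniformly recurrent word $\mathbf u=u_0u_1\cdots$, a return word to $w$ is $u_i\cdots u_{j-1}$ where $i<j$ are consecutive occurrences of $w$ in $\mathbf u$. Writing the return words as $r_0,\dots,r_{k-1}$, $\mathbf u$ factors uniquely as $r_{s_0}r_{s_1}\cdots$ and the derivated word is $d_{\mathbf u}(w)=s_0s_1s_2\cdots$ (equality of derivated words is up to a permutation of letters). A factor $v$ is right special if $vx$ and $vy$ are factors for two distinct letters $x,y$. -}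

module Defs where

open import Data.Bool using (Bool; true; false)
open import Data.Nat using (ℕ; zero; suc; _+_; _∸_; _<_; _≤_)
open import Data.Fin using (Fin)
open import Data.List using (List; []; _∷_; _++_; length; concatMap)
open import Data.List.Relation.Unary.All using (All)
open import Data.List.Relation.Unary.Unique.Propositional using (Unique)
open import Data.List.Membership.Propositional using (_∈_)
open import Data.Product using (Σ; ∃; _×_)
open import Relation.Binary.PropositionalEquality using (_≡_)
open import Function.Definitions using (Injective)

-- Infinite binary words: letter 0 is false, letter 1 is true.
Word : Set
Word = ℕ → Bool

factor : Word → ℕ → ℕ → List Bool
factor u i zero    = []
factor u i (suc n) = u i ∷ factor u (suc i) n

IsFactor : Word → List Bool → Set
IsFactor u v = ∃ λ i → factor u i (length v) ≡ v

IsPrefix : List Bool → Word → Set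
IsPrefix v u = factor u 0 (length v) ≡ v

Sturmian : Word → Set
Sturmian u = ∀ n → Σ (List (List Bool)) λ L →
    length L ≡ suc n
  × Unique L
  × All (λ v → length v ≡ n × IsFactor u v) L
  × (∀ v → length v ≡ n → IsFactor u v → v ∈ L)

φb : List Bool → List Bool
φb = concatMap img
  where
  img : Bool → List Bool
  img false = false ∷ []
  img true  = false ∷ true ∷ []

-- u = φ_b(u'): φ_b of every prefix of u' is a prefix of u
-- (φ_b is non-erasing, so this determines u uniquely)
IsφbImage : Word → Word → Set
IsφbImage u u' = ∀ n → IsPrefix (φb (factor u' 0 n)) u

-- w' is right special in u' (binary alphabet: both extensions are factors)
RightSpecial : Word → List Bool → Set
RightSpecial u v = IsFactor u (v ++ false ∷ []) × IsFactor u (v ++ true ∷ [])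

Occ : Word → List Bool → ℕ → Set
Occ u w i = factor u i (length w) ≡ w

IsOccEnum : Word → List Bool → (ℕ → ℕ) → Set
IsOccEnum u w e =
    (∀ n → e n < e (suc n))
  × (∀ n → Occ u w (e n))
  × (∀ i → Occ u w i → ∃ λ n → e n ≡ i)

IsReturnWord : Word → List Bool → List Bool → Set
IsReturnWord u w r = ∃ λ i → ∃ λ j →
    i < j × Occ u w i × Occ u w j
  × (∀ l → i < l → l < j → Occ u w l → Data.Empty.⊥)
  × r ≡ factor u i (j ∸ i)
  where import Data.Empty

-- d : ℕ → Fin k is the derivated word of u with respect to the prefix w,
-- w.r.t. the enumeration r_0, ..., r_{k-1} of the return words:
-- r is injective and lists exactly the return words, and
-- u = r_{d 0} r_{d 1} ... (the factorisation cut at consecutive occurrences of w)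
IsDerivated : Word → List Bool → (k : ℕ) → (Fin k → List Bool) → (ℕ → Fin k) → Set
IsDerivated u w k r d =
    Injective _≡_ _≡_ r
  × (∀ x → IsReturnWord u w (r x))
  × (∀ v → IsReturnWord u w v → ∃ λ x → r x ≡ v)
  × (∃ λ e → IsOccEnum u w e × (∀ n → r (d n) ≡ factor u (e n) (e (suc n) ∸ e n)))

-- Write u = φ_b(u') and let p i = |φ_b(u'_0 ⋯ u'_{i-1})| be the position in u
-- where the image of the i-th letter of u' starts.  Every image φ_b(a) begins with
-- 0 and contains no other 0.  So the 0s of u sit exactly at the positions p i,
-- and a factor of u that starts with 0 and ends with 0 is cut on image boundaries.
-- It follows that w = φ_b(w')0 occurs in u at position j iff j = p i for an
-- occurrence i of w' in u'.  The argument works for every w'.  Therefore: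
--   * p maps the occurrences of w' in u' increasingly onto those of w in u, so the
--     two occurrence enumerations satisfy e n = p (e' n);
--   * φ_b maps return words to w' bijectively onto return words to w, and φ_b is
--     injective, so it induces a bijection π between the two index sets;
--   * the n-th return word in u is φ_b of the n-th return word in u', so d = π ∘ d'.
module Submission where

open import Defs
open import Data.Bool using (Bool; true; false)
open import Data.Nat using (ℕ; zero; suc; _+_; _∸_; _<_; _≤_; z≤n; s≤s)
open import Data.Nat.Properties
open import Data.Fin using (Fin)
open import Data.List using (List; []; _∷_; _++_; length)
open import Data.List.Properties using (length-++; ∷-injectiveˡ; ∷-injectiveʳ)
open import Data.Product using (Σ; ∃; _×_; _,_; proj₁; proj₂)
open import Data.Sum using (inj₁; inj₂)
open import Data.Empty using (⊥; ⊥-elim)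
open import Relation.Nullary using (¬_; yes; no)
open import Relation.Binary.PropositionalEquality
  using (_≡_; refl; sym; trans; cong; cong₂; subst; module ≡-Reasoning)
open import Function.Bundles using (_⤖_; Bijection; mk⤖)
open import Function.Definitions using (Injective)

factor-++ : (v : Word) (i m n : ℕ) →
  factor v i (m + n) ≡ factor v i m ++ factor v (i + m) n
factor-++ v i zero    n rewrite +-identityʳ i = refl
factor-++ v i (suc m) n rewrite +-suc i m = cong (v i ∷_) (factor-++ v (suc i) m n)

factor-suffix : (v : Word) (i : ℕ) (xs ys : List Bool) →
  factor v i (length (xs ++ ys)) ≡ xs ++ ys → factor v (i + length xs) (length ys) ≡ ys
factor-suffix v i []       ys h rewrite +-identityʳ i = h
factor-suffix v i (x ∷ xs) ys h rewrite +-suc i (length xs) =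
  factor-suffix v (suc i) xs ys (∷-injectiveʳ h)

φb-++ : (xs ys : List Bool) → φb (xs ++ ys) ≡ φb xs ++ φb ys
φb-++ []           ys = refl
φb-++ (false ∷ xs) ys = cong (false ∷_) (φb-++ xs ys)
φb-++ (true ∷ xs)  ys = cong (λ z → false ∷ true ∷ z) (φb-++ xs ys)

φb-injective : (xs ys : List Bool) → φb xs ≡ φb ys → xs ≡ ys
φb-injective []           []           h = refl
φb-injective (false ∷ xs) (false ∷ ys) h = cong (false ∷_) (φb-injective xs ys (∷-injectiveʳ h))
φb-injective (true ∷ xs)  (true ∷ ys)  h =
  cong (true ∷_) (φb-injective xs ys (∷-injectiveʳ (∷-injectiveʳ h)))
φb-injective [] (false ∷ ys) ()
φb-injective [] (true ∷ ys) ()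
φb-injective (false ∷ xs) [] ()
φb-injective (true ∷ xs) [] ()
φb-injective (false ∷ []) (true ∷ ys) ()
φb-injective (false ∷ false ∷ xs) (true ∷ ys) ()
φb-injective (false ∷ true ∷ xs) (true ∷ ys) ()
φb-injective (true ∷ xs) (false ∷ []) ()
φb-injective (true ∷ xs) (false ∷ false ∷ ys) ()
φb-injective (true ∷ xs) (false ∷ true ∷ ys) ()

φb0-head : (u : Word) (v : List Bool) (j : ℕ) →
  Occ u (φb v ++ false ∷ []) j → u j ≡ false
φb0-head u []          j h = ∷-injectiveˡ h
φb0-head u (false ∷ v) j h = ∷-injectiveˡ h
φb0-head u (true ∷ v)  j h = ∷-injectiveˡ h

StrictlyIncreasing : (ℕ → ℕ) → Set
StrictlyIncreasing f = ∀ n → f n < f (suc n)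

module _ {f : ℕ → ℕ} (inc : StrictlyIncreasing f) where

  incr-< : ∀ {a b} → a < b → f a < f b
  incr-< {a} {suc b} (s≤s a≤b) with m≤n⇒m<n∨m≡n a≤b
  ... | inj₁ a<b  = <-trans (incr-< a<b) (inc b)
  ... | inj₂ refl = inc a

  incr-≤ : ∀ {a b} → a ≤ b → f a ≤ f b
  incr-≤ a≤b with m≤n⇒m<n∨m≡n a≤b
  ... | inj₁ a<b  = <⇒≤ (incr-< a<b)
  ... | inj₂ refl = ≤-refl

  incr-reflect-< : ∀ {a b} → f a < f b → a < b
  incr-reflect-< {a} {b} h with a <? b
  ... | yes a<b = a<b
  ... | no  a≮b = ⊥-elim (<⇒≱ h (incr-≤ (≮⇒≥ a≮b)))

enum-≤ : ∀ {e g : ℕ → ℕ} → StrictlyIncreasing e → StrictlyIncreasing g →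
  (∀ n → ∃ λ m → e m ≡ g n) → ∀ n → e n ≤ g n
enum-≤ {e} {g} ie ig cov zero with cov 0
... | m , em≡g0 = subst (e 0 ≤_) em≡g0 (incr-≤ ie z≤n)
enum-≤ {e} {g} ie ig cov (suc n) with cov (suc n)
... | m , em≡gn+1 = subst (e (suc n) ≤_) em≡gn+1 (incr-≤ ie n<m)
  where
  -- e n ≤ g n < g (n + 1) = e m, hence n < m
  n<m : n < m
  n<m = incr-reflect-< ie
    (≤-<-trans (enum-≤ ie ig cov n) (subst (g n <_) (sym em≡gn+1) (ig n)))

enum-unique : ∀ {e g : ℕ → ℕ} → StrictlyIncreasing e → StrictlyIncreasing g →
  (∀ n → ∃ λ m → e m ≡ g n) → (∀ n → ∃ λ m → g m ≡ e n) → ∀ n → e n ≡ g n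
enum-unique ie ig c₁ c₂ n = ≤-antisym (enum-≤ ie ig c₁ n) (enum-≤ ig ie c₂ n)

module Image (u u' : Word) (u≡φbu' : IsφbImage u u') where

  p : ℕ → ℕ
  p i = length (φb (factor u' 0 i))

  image-occurs : ∀ a m → factor u (p a) (length (φb (factor u' a m))) ≡ φb (factor u' a m)
  image-occurs a m = factor-suffix u 0 (φb (factor u' 0 a)) (φb (factor u' a m))
    (subst (λ z → factor u 0 (length z) ≡ z) φb-split (u≡φbu' (a + m)))
    where
    φb-split : φb (factor u' 0 (a + m)) ≡ φb (factor u' 0 a) ++ φb (factor u' a m)
    φb-split = trans (cong φb (factor-++ u' 0 a m)) (φb-++ (factor u' 0 a) (factor u' a m))

  p-+ : ∀ a m → p (a + m) ≡ p a + length (φb (factor u' a m))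
  p-+ a m = begin
    length (φb (factor u' 0 (a + m)))
      ≡⟨ cong (λ z → length (φb z)) (factor-++ u' 0 a m) ⟩
    length (φb (factor u' 0 a ++ factor u' a m))
      ≡⟨ cong length (φb-++ (factor u' 0 a) (factor u' a m)) ⟩
    length (φb (factor u' 0 a) ++ φb (factor u' a m))
      ≡⟨ length-++ (φb (factor u' 0 a)) ⟩
    p a + length (φb (factor u' a m)) ∎
    where open ≡-Reasoning

  p-suc : ∀ i → p (suc i) ≡ p i + length (φb (u' i ∷ []))
  p-suc i = trans (cong p (+-comm 1 i)) (p-+ i 1)

  data LetterImage (i : ℕ) : Set where
    image0 : u' i ≡ false → u (p i) ≡ false → p (suc i) ≡ suc (p i) → LetterImage i
    image1 : u' i ≡ true  → u (p i) ≡ false → u (suc (p i)) ≡ true →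
             p (suc i) ≡ suc (suc (p i)) → LetterImage i

  letterImage : ∀ i → LetterImage i
  letterImage i with u' i in eq | image-occurs i 1 | p-suc i
  ... | false | occ | len =
    image0 eq (∷-injectiveˡ occ) (trans len (+-comm (p i) 1))
  ... | true  | occ | len =
    image1 eq (∷-injectiveˡ occ) (∷-injectiveˡ (∷-injectiveʳ occ)) (trans len (+-comm (p i) 2))

  p-zero : ∀ i → u (p i) ≡ false
  p-zero i with letterImage i
  ... | image0 _ u≡0 _   = u≡0
  ... | image1 _ u≡0 _ _ = u≡0

  p-increasing : StrictlyIncreasing p
  p-increasing i with letterImage i
  ... | image0 _ _ p≡   = subst (p i <_) (sym p≡) ≤-refl
  ... | image1 _ _ _ p≡ = subst (p i <_) (sym p≡) (n≤1+n (suc (p i)))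

  inImage : ∀ j → ∃ λ i → p i ≤ j × j < p (suc i)
  inImage zero = 0 , z≤n , p-increasing 0
  inImage (suc j) with inImage j
  ... | i , pi≤j , j<pi+1 with m≤n⇒m<n∨m≡n j<pi+1
  ... | inj₁ j+1<pi+1 = i , m≤n⇒m≤1+n pi≤j , j+1<pi+1
  ... | inj₂ j+1≡pi+1 =
    suc i , ≤-reflexive (sym j+1≡pi+1) , subst (_< p (suc (suc i))) (sym j+1≡pi+1) (p-increasing (suc i))

  -- The 0s of u are exactly at the positions p i: inside an image 01 the 1 follows p i.
  zero-at-p : ∀ j → u j ≡ false → ∃ λ i → p i ≡ j
  zero-at-p j uj≡0 with inImage j
  ... | i , pi≤j , j<pi+1 with m≤n⇒m<n∨m≡n pi≤j
  ... | inj₂ pi≡j = i , pi≡j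
  ... | inj₁ pi<j with letterImage i
  ...   | image0 _ _ p≡ = ⊥-elim (<⇒≱ pi<j (≤-pred (subst (j <_) p≡ j<pi+1)))
  ...   | image1 _ _ u≡1 p≡ with ≤-antisym (≤-pred (subst (j <_) p≡ j<pi+1)) pi<j
  ...     | refl with trans (sym u≡1) uj≡0
  ...       | ()

  image-between : ∀ a b → a ≤ b → factor u (p a) (p b ∸ p a) ≡ φb (factor u' a (b ∸ a))
  image-between a b a≤b =
    subst (λ z → factor u (p a) z ≡ φb (factor u' a (b ∸ a))) (sym length≡) (image-occurs a (b ∸ a))
    where
    open ≡-Reasoning
    length≡ : p b ∸ p a ≡ length (φb (factor u' a (b ∸ a)))
    length≡ = begin
      p b ∸ p a                                      ≡⟨ cong (λ z → p z ∸ p a) (sym (m+[n∸m]≡n a≤b)) ⟩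
      p (a + (b ∸ a)) ∸ p a                          ≡⟨ cong (_∸ p a) (p-+ a (b ∸ a)) ⟩
      p a + length (φb (factor u' a (b ∸ a))) ∸ p a  ≡⟨ m+n∸m≡n (p a) _ ⟩
      length (φb (factor u' a (b ∸ a)))              ∎

  -- v occurs in u' at i iff φ_b(v)0 occurs in u at p i.  The trailing 0 makes the
  -- converse work: it rules out reading the image 01 where v has 0.
  occ-image : ∀ v i → Occ u' v i → Occ u (φb v ++ false ∷ []) (p i)
  occ-image [] i _ = cong (_∷ []) (p-zero i)
  occ-image (false ∷ v) i occ with letterImage i
  ... | image0 _ u≡0 p≡ rewrite u≡0 =
    cong (false ∷_) (subst (λ z → Occ u _ z) p≡ (occ-image v (suc i) (∷-injectiveʳ occ)))
  ... | image1 u'≡1 _ _ _ with trans (sym u'≡1) (∷-injectiveˡ occ)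
  ...   | ()
  occ-image (true ∷ v) i occ with letterImage i
  ... | image1 _ u≡0 u≡1 p≡ rewrite u≡0 | u≡1 =
    cong (λ z → false ∷ true ∷ z) (subst (λ z → Occ u _ z) p≡ (occ-image v (suc i) (∷-injectiveʳ occ)))
  ... | image0 u'≡0 _ _ with trans (sym u'≡0) (∷-injectiveˡ occ)
  ...   | ()

  occ-preimage : ∀ v i → Occ u (φb v ++ false ∷ []) (p i) → Occ u' v i
  occ-preimage [] i _ = refl
  occ-preimage (false ∷ v) i occ with letterImage i
  ... | image0 u'≡0 _ p≡ =
    cong₂ _∷_ u'≡0 (occ-preimage v (suc i) (subst (λ z → Occ u _ z) (sym p≡) (∷-injectiveʳ occ)))
  ... | image1 _ _ u≡1 _ with trans (sym u≡1) (φb0-head u v (suc (p i)) (∷-injectiveʳ occ))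
  ...   | ()
  occ-preimage (true ∷ v) i occ with letterImage i
  ... | image1 u'≡1 _ _ p≡ =
    cong₂ _∷_ u'≡1 (occ-preimage v (suc i) (subst (λ z → Occ u _ z) (sym p≡) (∷-injectiveʳ (∷-injectiveʳ occ))))
  ... | image0 _ _ p≡ with trans (sym (∷-injectiveˡ (∷-injectiveʳ occ))) (subst (λ z → u z ≡ false) p≡ (p-zero (suc i)))
  ...   | ()

  module Occurrences (w' : List Bool) where

    w : List Bool
    w = φb w' ++ false ∷ []

    occ-w : ∀ j → Occ u w j → ∃ λ i → p i ≡ j × Occ u' w' i
    occ-w j occ with zero-at-p j (φb0-head u w' j occ)
    ... | i , refl = i , refl , occ-preimage w' i occ

    returnWord-image : ∀ v → IsReturnWord u' w' v → IsReturnWord u w (φb v)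
    returnWord-image _ (i , j , i<j , occ-i , occ-j , none , refl) =
      p i , p j , incr-< p-increasing i<j , occ-image w' i occ-i , occ-image w' j occ-j ,
      none-between , sym (image-between i j (<⇒≤ i<j))
      where
      none-between : ∀ l → p i < l → l < p j → Occ u w l → ⊥
      none-between l pi<l l<pj occ with occ-w l occ
      ... | c , refl , occ' =
        none c (incr-reflect-< p-increasing pi<l) (incr-reflect-< p-increasing l<pj) occ'

    returnWord-preimage : ∀ v → IsReturnWord u w v → ∃ λ v' → IsReturnWord u' w' v' × v ≡ φb v'
    returnWord-preimage _ (i , j , i<j , occ-i , occ-j , none , refl)
      with occ-w i occ-i | occ-w j occ-j
    ... | a , refl , occ-a | b , refl , occ-b =
      factor u' a (b ∸ a) , (a , b , a<b , occ-a , occ-b , none-between , refl) ,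
      image-between a b (<⇒≤ a<b)
      where
      a<b : a < b
      a<b = incr-reflect-< p-increasing i<j
      none-between : ∀ l → a < l → l < b → Occ u' w' l → ⊥
      none-between l a<l l<b occ =
        none (p l) (incr-< p-increasing a<l) (incr-< p-increasing l<b) (occ-image w' l occ)

    occEnum-image : ∀ {e' e} → IsOccEnum u' w' e' → IsOccEnum u w e → ∀ n → e n ≡ p (e' n)
    occEnum-image {e'} {e} (inc' , occ' , cov') (inc , occ , cov) =
      enum-unique inc (λ n → incr-< p-increasing (inc' n)) covers-image covered-by-image
      where
      covers-image : ∀ n → ∃ λ m → e m ≡ p (e' n)
      covers-image n = cov (p (e' n)) (occ-image w' (e' n) (occ' n))
      covered-by-image : ∀ n → ∃ λ m → p (e' m) ≡ e n
      covered-by-image n with occ-w (e n) (occ n)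
      ... | i , pi≡en , occ-i with cov' i occ-i
      ...   | m , refl = m , pi≡en

    returnWord-bijection : ∀ {k' k} {r' : Fin k' → List Bool} {r : Fin k → List Bool} →
      Injective _≡_ _≡_ r' → (∀ x → IsReturnWord u' w' (r' x)) → (∀ v → IsReturnWord u' w' v → ∃ λ x → r' x ≡ v) →
      Injective _≡_ _≡_ r  → (∀ x → IsReturnWord u w (r x))    → (∀ v → IsReturnWord u w v → ∃ λ x → r x ≡ v) →
      Σ (Fin k' ⤖ Fin k) λ π → ∀ x → r (Bijection.to π x) ≡ φb (r' x)
    returnWord-bijection {r' = r'} {r} inj' ret' all' inj ret all =
      mk⤖ {to = π} (π-injective , π-surjective) , λ x → proj₂ (index x)
      where
      index : ∀ x → ∃ λ y → r y ≡ φb (r' x)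
      index x = all (φb (r' x)) (returnWord-image (r' x) (ret' x))
      π : Fin _ → Fin _
      π x = proj₁ (index x)
      π-injective : ∀ {x y} → π x ≡ π y → x ≡ y
      π-injective {x} {y} πx≡πy = inj' (φb-injective _ _
        (trans (sym (proj₂ (index x))) (trans (cong r πx≡πy) (proj₂ (index y)))))
      π-surjective : ∀ y → ∃ λ x → ∀ {z} → z ≡ x → π z ≡ y
      π-surjective y with returnWord-preimage (r y) (ret y)
      ... | v' , ret-v' , ry≡φbv' with all' v' ret-v'
      ...   | x , r'x≡v' =
        x , λ { refl → inj (trans (proj₂ (index x)) (trans (cong φb r'x≡v') (sym ry≡φbv'))) }

    derivated-image : ∀ {k' k} {r' : Fin k' → List Bool} {d' : ℕ → Fin k'}
      {r : Fin k → List Bool} {d : ℕ → Fin k} →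
      IsDerivated u' w' k' r' d' → IsDerivated u w k r d →
      Σ (Fin k' ⤖ Fin k) λ π → ∀ n → d n ≡ Bijection.to π (d' n)
    derivated-image {r' = r'} {d'} {r} {d}
      (inj' , ret' , all' , e' , enum' , cut')
      (inj  , ret  , all  , e  , enum  , cut) = π , same-index
      where
      open ≡-Reasoning
      bij : Σ (Fin _ ⤖ Fin _) λ π → ∀ x → r (Bijection.to π x) ≡ φb (r' x)
      bij = returnWord-bijection inj' ret' all' inj ret all
      π : Fin _ ⤖ Fin _
      π = proj₁ bij
      e≡pe' : ∀ n → e n ≡ p (e' n)
      e≡pe' = occEnum-image enum' enum
      same-index : ∀ n → d n ≡ Bijection.to π (d' n)
      same-index n = inj (begin
        r (d n)                                               ≡⟨ cut n ⟩
        factor u (e n) (e (suc n) ∸ e n)                      ≡⟨ cong₂ (λ a b → factor u a (b ∸ a)) (e≡pe' n) (e≡pe' (suc n)) ⟩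
        factor u (p (e' n)) (p (e' (suc n)) ∸ p (e' n))       ≡⟨ image-between (e' n) (e' (suc n)) (<⇒≤ (proj₁ enum' n)) ⟩
        φb (factor u' (e' n) (e' (suc n) ∸ e' n))             ≡⟨ cong φb (sym (cut' n)) ⟩
        φb (r' (d' n))                                        ≡⟨ sym (proj₂ bij (d' n)) ⟩
        r (Bijection.to π (d' n))                             ∎)

-- Theorem 5.  The proof uses only u = φ_b(u').
mainTheorem5 : (u u' : Word) → Sturmian u → Sturmian u' → IsφbImage u u' →
    (w' : List Bool) → ¬ (w' ≡ []) → IsPrefix w' u' → RightSpecial u' w' →
    (k' : ℕ) (r' : Fin k' → List Bool) (d' : ℕ → Fin k') →
    IsDerivated u' w' k' r' d' →
    (k : ℕ) (r : Fin k → List Bool) (d : ℕ → Fin k) →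
    IsDerivated u (φb w' ++ false ∷ []) k r d →
    Σ (Fin k' ⤖ Fin k) λ π → ∀ n → d n ≡ Bijection.to π (d' n)
mainTheorem5 u u' _ _ u≡φbu' w' _ _ _ k' r' d' der' k r d der =
  Image.Occurrences.derivated-image u u' u≡φbu' w' der' der
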